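{- Let $G$ be an abelian group with $|G|=m$, and let $A\subseteq G$ be a subset with $|A|=e+1$. If $m<\binom{e+k-1}{k-1}+e\binom{e+k-2}{k-1}$ for some integer $k>0$, then $|kA|<\binom{e+k}{k}$.
   Context: For subsets $A,B$ of an abelian group $G$ (written additively), $A+B=\{a+b: a\in A, b\in B\}$, and for $k\in\mathbb{N}$, $kA=\{\sum_i\lambda_ia_i: a_i\in A,\lambda_i\in\mathbb{N},\sum_i\lambda_i=k\}$ is the $k$-fold sumset $A+\cdots+A$ ($k$ times). -}

module Defs where

open import Data.Nat using (ℕ; zero; suc)
open import Data.Bool using (Bool; true; false; _∧_; _∨_)
open import Data.List using (foldr; map; allFin)
open import Data.Vec using (tabulate; lookup)
open import Data.Fin using (Fin; _≟_)
open import Data.Fin.Subset using (Subset; ⁅_⁆)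
open import Relation.Nullary.Decidable using (⌊_⌋)

-- A finite abelian group of order m is represented (up to isomorphism) by a
-- group structure on Fin m with propositional equality; subsets are Subset m.

anyFin : {m : ℕ} → (Fin m → Bool) → Bool
anyFin {m} f = foldr _∨_ false (map f (allFin m))

sumset : {m : ℕ} → (Fin m → Fin m → Fin m) → Subset m → Subset m → Subset m
sumset _+_ A B = tabulate λ z →
  anyFin λ x → anyFin λ y → lookup A x ∧ lookup B y ∧ ⌊ (x + y) ≟ z ⌋

kfold : {m : ℕ} → (Fin m → Fin m → Fin m) → Fin m → ℕ → Subset m → Subset m
kfold _+_ 0g zero    A = ⁅ 0g ⁆
kfold _+_ 0g (suc k) A = sumset _+_ A (kfold _+_ 0g k A)

-- Removing an element b from B gives (j+1)B ⊆ (b + jB) ∪ (j+1)(B − b), which together with Pascal's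
-- rule bounds |jB| by the number C(|B|+j−1, j) of j-element multisets from B. If |(k+1)A| attains
-- this bound, every such inclusion is tight: for b ∈ A both kA and (k+1)(A − b) attain their bounds,
-- and b + kA is disjoint from (k+1)(A − b). Fix a₀ ∈ A. Then kA and the e translates
-- (a₀ − b) + k(A − b), b ∈ A − a₀, are pairwise disjoint, since shifting by b turns a common element
-- into one of b + kA and a₀ + k(A − b) (or b′ + k(A − b)) ⊆ (k+1)(A − b). Their sizes are
-- C(e+k, k) and C(e+k−1, k), so |G| ≥ C(e+k, k) + e·C(e+k−1, k).

module Submission where

open import Defs
open import Data.Nat using (ℕ; zero; suc; _+_; _*_; _∸_; _<_; _≤_; z≤n; s≤s)
open import Data.Nat.Properties
  using (≤-reflexive; ≤-antisym; ≤-trans; ≤-<-trans; <-irrefl; +-suc; +-identityʳ;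
         +-mono-≤; +-monoˡ-≤; +-monoʳ-≤; m≤m+n; m<m+n; module ≤-Reasoning; +-cancelˡ-≤; +-cancelʳ-≤; <⇒≱; ≰⇒>)
  renaming (suc-injective to ℕ-suc-injective)
open import Data.Nat.Combinatorics using (_C_; nCk+nC[k+1]≡[n+1]C[k+1])
open import Data.Bool using (Bool; T)
open import Data.Bool.Properties using (T-≡; T-∧)
open import Data.Fin using (Fin; zero; suc; _≟_)
open import Data.Fin.Properties using (suc-injective; 0≢1+n)
open import Data.Fin.Subset
open import Data.Fin.Subset.Properties
open import Data.Vec using ([]; _∷_; lookup; tabulate; here; there)
open import Data.Vec.Properties using (lookup∘tabulate; lookup⇒[]=; []=⇒lookup)
open import Data.List using (allFin)
open import Data.List.Membership.Propositional using (lose)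
open import Data.List.Membership.Propositional.Properties using (∈-allFin)
open import Data.List.Relation.Unary.Any using (satisfied)
open import Data.List.Relation.Unary.Any.Properties using (any⁺; any⁻)
open import Data.Product using (∃; ∃₂; _×_; _,_; proj₁; proj₂)
open import Data.Sum using (_⊎_; inj₁; inj₂)
open import Function using (_∘_; id; Equivalence; Injective)
open import Relation.Nullary using (contradiction; yes; no)
open import Relation.Nullary.Decidable using (toWitness; fromWitness)
open import Relation.Binary.PropositionalEquality
open import Level using (0ℓ)
open import Algebra.Bundles using (AbelianGroup)
open import Algebra.Structures using (IsAbelianGroup)
import Algebra.Properties.AbelianGroup as AbelianGroupProperties
import Algebra.Properties.CommutativeSemigroup as CommutativeSemigroupProperties

private variable
  n : ℕ
  x y : Fin n
  p q : Subset n

+-squeeze-≤ : ∀ {a d x y} → x ≤ a → y ≤ d → a + d ≤ x + y → a ≤ x × d ≤ y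
+-squeeze-≤ {a} {d} {x} {y} x≤a y≤d a+d≤x+y =
  +-cancelʳ-≤ d a x (≤-trans a+d≤x+y (+-monoʳ-≤ x y≤d)) ,
  +-cancelˡ-≤ a d y (≤-trans a+d≤x+y (+-monoˡ-≤ y x≤a))

x∈p─q⇒x∉q : x ∈ p ─ q → x ∉ q
x∈p─q⇒x∉q {p = inside ∷ p} {q = outside ∷ q} here ()
x∈p─q⇒x∉q {p = _ ∷ p} {q = _ ∷ q} (there x∈p─q) (there x∈q) = x∈p─q⇒x∉q x∈p─q x∈q

x∈p-y⇒x≢y : x ∈ p - y → x ≢ y
x∈p-y⇒x≢y x∈p-y refl = x∈p─q⇒x∉q x∈p-y (x∈⁅x⁆ _)

x∈p⇒suc∣p-x∣≡∣p∣ : x ∈ p → suc ∣ p - x ∣ ≡ ∣ p ∣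
x∈p⇒suc∣p-x∣≡∣p∣ {p = inside ∷ p} here = cong suc (cong ∣_∣ (p─⊥≡p p))
x∈p⇒suc∣p-x∣≡∣p∣ {p = inside ∷ p} (there x∈p) = cong suc (x∈p⇒suc∣p-x∣≡∣p∣ x∈p)
x∈p⇒suc∣p-x∣≡∣p∣ {p = outside ∷ p} (there x∈p) = x∈p⇒suc∣p-x∣≡∣p∣ x∈p

x∈p⇒∣p∣≡1+c⇒∣p-x∣≡c : ∀ {c} → x ∈ p → ∣ p ∣ ≡ suc c → ∣ p - x ∣ ≡ c
x∈p⇒∣p∣≡1+c⇒∣p-x∣≡c x∈p ∣p∣≡1+c = ℕ-suc-injective (trans (x∈p⇒suc∣p-x∣≡∣p∣ x∈p) ∣p∣≡1+c)

x∈p⇒0<∣p∣ : x ∈ p → 0 < ∣ p ∣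
x∈p⇒0<∣p∣ x∈p = ≤-<-trans z≤n (x∈p⇒∣p-x∣<∣p∣ x∈p)

∣p∣≡suc⇒Nonempty : ∀ {c} (p : Subset n) → ∣ p ∣ ≡ suc c → Nonempty p
∣p∣≡suc⇒Nonempty (inside ∷ p) _ = zero , here
∣p∣≡suc⇒Nonempty (outside ∷ p) eq with ∣p∣≡suc⇒Nonempty p eq
... | x , x∈p = suc x , there x∈p

∣p∪q∣+∣p∩q∣≡∣p∣+∣q∣ : ∀ (p q : Subset n) → ∣ p ∪ q ∣ + ∣ p ∩ q ∣ ≡ ∣ p ∣ + ∣ q ∣
∣p∪q∣+∣p∩q∣≡∣p∣+∣q∣ [] [] = refl
∣p∪q∣+∣p∩q∣≡∣p∣+∣q∣ (inside ∷ p) (inside ∷ q) = cong suc (begin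
  ∣ p ∪ q ∣ + suc ∣ p ∩ q ∣  ≡⟨ +-suc ∣ p ∪ q ∣ ∣ p ∩ q ∣ ⟩
  suc (∣ p ∪ q ∣ + ∣ p ∩ q ∣) ≡⟨ cong suc (∣p∪q∣+∣p∩q∣≡∣p∣+∣q∣ p q) ⟩
  suc (∣ p ∣ + ∣ q ∣)         ≡⟨ +-suc ∣ p ∣ ∣ q ∣ ⟨
  ∣ p ∣ + suc ∣ q ∣           ∎)
  where open ≡-Reasoning
∣p∪q∣+∣p∩q∣≡∣p∣+∣q∣ (inside ∷ p) (outside ∷ q) = cong suc (∣p∪q∣+∣p∩q∣≡∣p∣+∣q∣ p q)
∣p∪q∣+∣p∩q∣≡∣p∣+∣q∣ (outside ∷ p) (inside ∷ q) =
  trans (cong suc (∣p∪q∣+∣p∩q∣≡∣p∣+∣q∣ p q)) (sym (+-suc ∣ p ∣ ∣ q ∣))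
∣p∪q∣+∣p∩q∣≡∣p∣+∣q∣ (outside ∷ p) (outside ∷ q) = ∣p∪q∣+∣p∩q∣≡∣p∣+∣q∣ p q

∣p∪q∣≤∣p∣+∣q∣ : ∀ (p q : Subset n) → ∣ p ∪ q ∣ ≤ ∣ p ∣ + ∣ q ∣
∣p∪q∣≤∣p∣+∣q∣ p q = ≤-trans (m≤m+n _ _) (≤-reflexive (∣p∪q∣+∣p∩q∣≡∣p∣+∣q∣ p q))

Disjoint : Subset n → Subset n → Set
Disjoint p q = ∀ {x} → x ∈ p → x ∉ q

Disjoint⇒∣p∪q∣≡∣p∣+∣q∣ : ∀ {n} (p q : Subset n) → Disjoint p q → ∣ p ∪ q ∣ ≡ ∣ p ∣ + ∣ q ∣
Disjoint⇒∣p∪q∣≡∣p∣+∣q∣ {n} p q disjoint = begin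
  ∣ p ∪ q ∣             ≡⟨ +-identityʳ _ ⟨
  ∣ p ∪ q ∣ + 0         ≡⟨ cong (∣ p ∪ q ∣ +_) ∣p∩q∣≡0 ⟨
  ∣ p ∪ q ∣ + ∣ p ∩ q ∣ ≡⟨ ∣p∪q∣+∣p∩q∣≡∣p∣+∣q∣ p q ⟩
  ∣ p ∣ + ∣ q ∣         ∎
  where
  open ≡-Reasoning
  p∩q-empty : Empty (p ∩ q)
  p∩q-empty (_ , x∈p∩q) = let x∈p , x∈q = x∈p∩q⁻ p q x∈p∩q in disjoint x∈p x∈q
  ∣p∩q∣≡0 : ∣ p ∩ q ∣ ≡ 0
  ∣p∩q∣≡0 = trans (cong ∣_∣ (Empty-unique p∩q-empty)) (∣⊥∣≡0 n)

∣p∣+∣q∣≤∣p∪q∣⇒Disjoint : ∀ (p q : Subset n) → ∣ p ∣ + ∣ q ∣ ≤ ∣ p ∪ q ∣ → Disjoint p q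
∣p∣+∣q∣≤∣p∪q∣⇒Disjoint p q ∣p∣+∣q∣≤∣p∪q∣ x∈p x∈q = <-irrefl refl (begin-strict
  ∣ p ∪ q ∣              <⟨ m<m+n _ (x∈p⇒0<∣p∣ (x∈p∩q⁺ (x∈p , x∈q))) ⟩
  ∣ p ∪ q ∣ + ∣ p ∩ q ∣  ≡⟨ ∣p∪q∣+∣p∩q∣≡∣p∣+∣q∣ p q ⟩
  ∣ p ∣ + ∣ q ∣          ≤⟨ ∣p∣+∣q∣≤∣p∪q∣ ⟩
  ∣ p ∪ q ∣              ∎)
  where open ≤-Reasoning

∣p∣≤∣q∣-by-injection : ∀ {m} {p : Subset m} {q : Subset n} (f : Fin m → Fin n) → Injective _≡_ _≡_ f
  → (∀ {x} → x ∈ p → f x ∈ q) → ∣ p ∣ ≤ ∣ q ∣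
∣p∣≤∣q∣-by-injection {p = []} f f-inj f[p]⊆q = z≤n
∣p∣≤∣q∣-by-injection {p = outside ∷ p} f f-inj f[p]⊆q =
  ∣p∣≤∣q∣-by-injection (f ∘ suc) (suc-injective ∘ f-inj) (f[p]⊆q ∘ there)
∣p∣≤∣q∣-by-injection {p = inside ∷ p} {q} f f-inj f[p]⊆q = begin
  suc ∣ p ∣           ≤⟨ s≤s (∣p∣≤∣q∣-by-injection (f ∘ suc) (suc-injective ∘ f-inj) f[suc-p]⊆q-f0) ⟩
  suc ∣ q - f zero ∣  ≡⟨ x∈p⇒suc∣p-x∣≡∣p∣ (f[p]⊆q here) ⟩
  ∣ q ∣               ∎
  where
  open ≤-Reasoning
  f[suc-p]⊆q-f0 : ∀ {x} → x ∈ p → f (suc x) ∈ q - f zero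
  f[suc-p]⊆q-f0 x∈p = x∈p∧x≢y⇒x∈p-y (f[p]⊆q (there x∈p)) (0≢1+n ∘ sym ∘ f-inj)

⋃[_]_ : ∀ {k} → Subset k → (Fin k → Subset n) → Subset n
⋃[ [] ] S = ⊥
⋃[ inside ∷ D ] S = S zero ∪ ⋃[ D ] (S ∘ suc)
⋃[ outside ∷ D ] S = ⋃[ D ] (S ∘ suc)

∈-⋃⁻ : ∀ {k} (D : Subset k) (S : Fin k → Subset n) → x ∈ ⋃[ D ] S → ∃ λ b → b ∈ D × x ∈ S b
∈-⋃⁻ [] S x∈⊥ = contradiction x∈⊥ ∉⊥
∈-⋃⁻ (inside ∷ D) S x∈⋃ with x∈p∪q⁻ (S zero) (⋃[ D ] (S ∘ suc)) x∈⋃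
... | inj₁ x∈S0 = zero , here , x∈S0
... | inj₂ x∈⋃D = let b , b∈D , x∈Sb = ∈-⋃⁻ D (S ∘ suc) x∈⋃D in suc b , there b∈D , x∈Sb
∈-⋃⁻ (outside ∷ D) S x∈⋃ = let b , b∈D , x∈Sb = ∈-⋃⁻ D (S ∘ suc) x∈⋃ in suc b , there b∈D , x∈Sb

PairwiseDisjoint : ∀ {k} → Subset k → (Fin k → Subset n) → Set
PairwiseDisjoint D S = ∀ {b b′} → b ∈ D → b′ ∈ D → b ≢ b′ → Disjoint (S b) (S b′)

PairwiseDisjoint-∷⁻ : ∀ {k s} {D : Subset k} {S : Fin (suc k) → Subset n}
  → PairwiseDisjoint (s ∷ D) S → PairwiseDisjoint D (S ∘ suc)
PairwiseDisjoint-∷⁻ disjoint b∈D b′∈D b≢b′ = disjoint (there b∈D) (there b′∈D) (b≢b′ ∘ suc-injective)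

∣D∣*s≤∣⋃[D]S∣ : ∀ {k s} (D : Subset k) (S : Fin k → Subset n)
  → (∀ {b} → b ∈ D → s ≤ ∣ S b ∣) → PairwiseDisjoint D S → ∣ D ∣ * s ≤ ∣ ⋃[ D ] S ∣
∣D∣*s≤∣⋃[D]S∣ [] S large disjoint = z≤n
∣D∣*s≤∣⋃[D]S∣ (outside ∷ D) S large disjoint =
  ∣D∣*s≤∣⋃[D]S∣ D (S ∘ suc) (large ∘ there) (PairwiseDisjoint-∷⁻ disjoint)
∣D∣*s≤∣⋃[D]S∣ {s = s} (inside ∷ D) S large disjoint = begin
  s + ∣ D ∣ * s                     ≤⟨ +-mono-≤ (large here) ∣D∣*s≤∣⋃[D]S∘suc∣ ⟩
  ∣ S zero ∣ + ∣ ⋃[ D ] (S ∘ suc) ∣ ≡⟨ Disjoint⇒∣p∪q∣≡∣p∣+∣q∣ (S zero) (⋃[ D ] (S ∘ suc)) S0∩⋃=∅ ⟨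
  ∣ S zero ∪ ⋃[ D ] (S ∘ suc) ∣     ∎
  where
  open ≤-Reasoning
  ∣D∣*s≤∣⋃[D]S∘suc∣ : ∣ D ∣ * s ≤ ∣ ⋃[ D ] (S ∘ suc) ∣
  ∣D∣*s≤∣⋃[D]S∘suc∣ = ∣D∣*s≤∣⋃[D]S∣ D (S ∘ suc) (large ∘ there) (PairwiseDisjoint-∷⁻ disjoint)
  S0∩⋃=∅ : Disjoint (S zero) (⋃[ D ] (S ∘ suc))
  S0∩⋃=∅ x∈S0 x∈⋃ = let b , b∈D , x∈Sb = ∈-⋃⁻ D (S ∘ suc) x∈⋃ in
    disjoint here (there b∈D) 0≢1+n x∈S0 x∈Sb

∈-tabulate⁻ : ∀ {f : Fin n → Bool} {z} → z ∈ tabulate f → T (f z)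
∈-tabulate⁻ {f = f} {z} z∈ = Equivalence.from T-≡ (trans (sym (lookup∘tabulate f z)) ([]=⇒lookup z∈))

∈-tabulate⁺ : ∀ {f : Fin n → Bool} {z} → T (f z) → z ∈ tabulate f
∈-tabulate⁺ {f = f} {z} t = lookup⇒[]= z (tabulate f) (trans (lookup∘tabulate f z) (Equivalence.to T-≡ t))

∈⇒T-lookup : x ∈ p → T (lookup p x)
∈⇒T-lookup x∈p = Equivalence.from T-≡ ([]=⇒lookup x∈p)

T-lookup⇒∈ : T (lookup p x) → x ∈ p
T-lookup⇒∈ {p = p} {x} t = lookup⇒[]= x p (Equivalence.to T-≡ t)

T-anyFin⁻ : ∀ {f : Fin n → Bool} → T (anyFin f) → ∃ λ x → T (f x)
T-anyFin⁻ {n} {f} t = satisfied (any⁻ f (allFin n) t)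

T-anyFin⁺ : ∀ {f : Fin n → Bool} x → T (f x) → T (anyFin f)
T-anyFin⁺ {f = f} x t = any⁺ f (lose (∈-allFin x) t)

module _ {m : ℕ} (_∙_ : Fin m → Fin m → Fin m) where

  ∈-sumset⁻ : ∀ A B {z} → z ∈ sumset _∙_ A B → ∃₂ λ x y → x ∈ A × y ∈ B × x ∙ y ≡ z
  ∈-sumset⁻ A B z∈A+B =
    let x , t = T-anyFin⁻ (∈-tabulate⁻ z∈A+B)
        y , t′ = T-anyFin⁻ t
        x∈A , t″ = Equivalence.to T-∧ t′
        y∈B , x∙y≡z = Equivalence.to T-∧ t″
    in x , y , T-lookup⇒∈ {p = A} x∈A , T-lookup⇒∈ {p = B} y∈B , toWitness x∙y≡z

  ∈-sumset⁺ : ∀ {A B x y} → x ∈ A → y ∈ B → x ∙ y ∈ sumset _∙_ A B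
  ∈-sumset⁺ {x = x} {y} x∈A y∈B = ∈-tabulate⁺ (T-anyFin⁺ x (T-anyFin⁺ y
    (Equivalence.from T-∧ (∈⇒T-lookup x∈A , Equivalence.from T-∧ (∈⇒T-lookup y∈B , fromWitness refl)))))

  sumset-mono : ∀ {A A′ B B′} → A ⊆ A′ → B ⊆ B′ → sumset _∙_ A B ⊆ sumset _∙_ A′ B′
  sumset-mono {A} {B = B} A⊆A′ B⊆B′ z∈A+B with ∈-sumset⁻ A B z∈A+B
  ... | x , y , x∈A , y∈B , refl = ∈-sumset⁺ (A⊆A′ x∈A) (B⊆B′ y∈B)

  kfold-mono : ∀ {ε A A′} k → A ⊆ A′ → kfold _∙_ ε k A ⊆ kfold _∙_ ε k A′
  kfold-mono zero A⊆A′ = id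
  kfold-mono (suc k) A⊆A′ = sumset-mono A⊆A′ (kfold-mono k A⊆A′)

multichoose : ℕ → ℕ → ℕ
multichoose c j = (c + j ∸ 1) C j

multichoose-pascal : ∀ c j → multichoose (suc c) j + multichoose c (suc j) ≡ multichoose (suc c) (suc j)
multichoose-pascal c j rewrite +-suc c j = nCk+nC[k+1]≡[n+1]C[k+1] (c + j) j

module _ {m : ℕ} {_∙_ : Fin m → Fin m → Fin m} {ε : Fin m} {_⁻¹ : Fin m → Fin m}
         (isAbelianGroup : IsAbelianGroup _≡_ _∙_ ε _⁻¹) where

  private
    G : AbelianGroup 0ℓ 0ℓ
    G = record { isAbelianGroup = isAbelianGroup }

  open AbelianGroup G using (assoc; commutativeSemigroup)
  open AbelianGroupProperties G using (∙-cancelˡ; xyx⁻¹≈y; \\-leftDividesʳ)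
  open CommutativeSemigroupProperties commutativeSemigroup using (x∙yz≈y∙xz)

  infix 8 _·_
  _·_ : ℕ → Subset m → Subset m
  k · A = kfold _∙_ ε k A

  translate : Fin m → Subset m → Subset m
  translate c X = sumset _∙_ ⁅ c ⁆ X

  ∈-translate⁺ : ∀ {c X y} → y ∈ X → c ∙ y ∈ translate c X
  ∈-translate⁺ = ∈-sumset⁺ _∙_ (x∈⁅x⁆ _)

  ∈-translate⁻ : ∀ c X {z} → z ∈ translate c X → ∃ λ y → y ∈ X × c ∙ y ≡ z
  ∈-translate⁻ c X z∈c+X with ∈-sumset⁻ _∙_ ⁅ c ⁆ X z∈c+X
  ... | x , y , x∈⁅c⁆ , y∈X , refl = y , y∈X , cong (_∙ y) (sym (x∈⁅y⁆⇒x≡y c x∈⁅c⁆))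

  ∣translate∣≡∣X∣ : ∀ c X → ∣ translate c X ∣ ≡ ∣ X ∣
  ∣translate∣≡∣X∣ c X = ≤-antisym
    (∣p∣≤∣q∣-by-injection ((c ⁻¹) ∙_) (λ {x} {y} → ∙-cancelˡ (c ⁻¹) x y) c⁻¹+[c+X]⊆X)
    (∣p∣≤∣q∣-by-injection (c ∙_) (λ {x} {y} → ∙-cancelˡ c x y) (∈-translate⁺ {c} {X}))
    where
    c⁻¹+[c+X]⊆X : ∀ {z} → z ∈ translate c X → (c ⁻¹) ∙ z ∈ X
    c⁻¹+[c+X]⊆X z∈c+X with ∈-translate⁻ c X z∈c+X
    ... | y , y∈X , refl = subst (_∈ X) (sym (\\-leftDividesʳ c y)) y∈X

  b[ab⁻¹u]≡au : ∀ a b u → b ∙ ((a ∙ (b ⁻¹)) ∙ u) ≡ a ∙ u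
  b[ab⁻¹u]≡au a b u = begin
    b ∙ ((a ∙ (b ⁻¹)) ∙ u)   ≡⟨ assoc b _ u ⟨
    (b ∙ (a ∙ (b ⁻¹))) ∙ u   ≡⟨ cong (_∙ u) (assoc b a _) ⟨
    ((b ∙ a) ∙ (b ⁻¹)) ∙ u   ≡⟨ cong (_∙ u) (xyx⁻¹≈y b a) ⟩
    a ∙ u                    ∎
    where open ≡-Reasoning

  [ab⁻¹]u≡[ab′⁻¹]w⇒b′u≡bw : ∀ a b b′ u w → (a ∙ (b ⁻¹)) ∙ u ≡ (a ∙ (b′ ⁻¹)) ∙ w → b′ ∙ u ≡ b ∙ w
  [ab⁻¹]u≡[ab′⁻¹]w⇒b′u≡bw a b b′ u w eq = ∙-cancelˡ a _ _ (begin
    a ∙ (b′ ∙ u)                        ≡⟨ x∙yz≈y∙xz a b′ u ⟩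
    b′ ∙ (a ∙ u)                        ≡⟨ cong (b′ ∙_) (b[ab⁻¹u]≡au a b u) ⟨
    b′ ∙ (b ∙ ((a ∙ (b ⁻¹)) ∙ u))       ≡⟨ x∙yz≈y∙xz b′ b _ ⟩
    b ∙ (b′ ∙ ((a ∙ (b ⁻¹)) ∙ u))       ≡⟨ cong (λ t → b ∙ (b′ ∙ t)) eq ⟩
    b ∙ (b′ ∙ ((a ∙ (b′ ⁻¹)) ∙ w))      ≡⟨ cong (b ∙_) (b[ab⁻¹u]≡au a b′ w) ⟩
    b ∙ (a ∙ w)                         ≡⟨ x∙yz≈y∙xz b a w ⟩
    a ∙ (b ∙ w)                         ∎)
    where open ≡-Reasoning

  suc·B⊆b+j·B∪suc·[B-b] : ∀ {B} b j → suc j · B ⊆ translate b (j · B) ∪ suc j · (B - b)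
  suc·B⊆b+j·B∪suc·[B-b] {B} b j z∈ with ∈-sumset⁻ _∙_ B (j · B) z∈
  ... | x , y , x∈B , y∈j·B , refl with x ≟ b
  ... | yes refl = x∈p∪q⁺ (inj₁ (∈-translate⁺ y∈j·B))
  ... | no x≢b = x∈p∪q⁺ (extend j y∈j·B)
    where
    x∈B-b : x ∈ B - b
    x∈B-b = x∈p∧x≢y⇒x∈p-y x∈B x≢b
    extend : ∀ j → y ∈ j · B → x ∙ y ∈ translate b (j · B) ⊎ x ∙ y ∈ suc j · (B - b)
    extend zero y∈0·B = inj₂ (∈-sumset⁺ _∙_ x∈B-b y∈0·B)
    extend (suc j) y∈ with x∈p∪q⁻ (translate b (j · B)) (suc j · (B - b)) (suc·B⊆b+j·B∪suc·[B-b] b j y∈)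
    ... | inj₂ y∈suc·[B-b] = inj₂ (∈-sumset⁺ _∙_ x∈B-b y∈suc·[B-b])
    ... | inj₁ y∈b+j·B with ∈-translate⁻ b (j · B) y∈b+j·B
    ... | y′ , y′∈j·B , refl =
      inj₁ (subst (_∈ translate b (suc j · B)) (sym (x∙yz≈y∙xz x b y′))
        (∈-translate⁺ {b} {suc j · B} (∈-sumset⁺ _∙_ {A = B} {B = j · B} x∈B y′∈j·B)))

  ∣j·B∣≤multichoose : ∀ j B {c} → ∣ B ∣ ≡ c → ∣ j · B ∣ ≤ multichoose c j
  ∣j·B∣≤multichoose zero B _ = ≤-reflexive (∣⁅x⁆∣≡1 ε)
  ∣j·B∣≤multichoose (suc j) B {zero} ∣B∣≡0 =
    ≤-trans (≤-reflexive (trans (cong ∣_∣ (Empty-unique suc·B-empty)) (∣⊥∣≡0 m))) z≤n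
    where
    suc·B-empty : Empty (suc j · B)
    suc·B-empty (_ , z∈) with ∈-sumset⁻ _∙_ B (j · B) z∈
    ... | _ , _ , x∈B , _ = contradiction (subst (0 <_) ∣B∣≡0 (x∈p⇒0<∣p∣ x∈B)) λ ()
  ∣j·B∣≤multichoose (suc j) B {suc c} ∣B∣≡1+c with ∣p∣≡suc⇒Nonempty B ∣B∣≡1+c
  ... | b , b∈B = begin
    ∣ suc j · B ∣                                  ≤⟨ p⊆q⇒∣p∣≤∣q∣ (suc·B⊆b+j·B∪suc·[B-b] b j) ⟩
    ∣ translate b (j · B) ∪ suc j · (B - b) ∣      ≤⟨ ∣p∪q∣≤∣p∣+∣q∣ (translate b (j · B)) (suc j · (B - b)) ⟩
    ∣ translate b (j · B) ∣ + ∣ suc j · (B - b) ∣  ≡⟨ cong (_+ ∣ suc j · (B - b) ∣) (∣translate∣≡∣X∣ b (j · B)) ⟩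
    ∣ j · B ∣ + ∣ suc j · (B - b) ∣                ≤⟨ +-mono-≤ (∣j·B∣≤multichoose j B ∣B∣≡1+c)
                                                       (∣j·B∣≤multichoose (suc j) (B - b) ∣B-b∣≡c) ⟩
    multichoose (suc c) j + multichoose c (suc j)  ≡⟨ multichoose-pascal c j ⟩
    multichoose (suc c) (suc j)                    ∎
    where
    open ≤-Reasoning
    ∣B-b∣≡c : ∣ B - b ∣ ≡ c
    ∣B-b∣≡c = x∈p⇒∣p∣≡1+c⇒∣p-x∣≡c b∈B ∣B∣≡1+c

  Extremal : ℕ → Subset m → Set
  Extremal j B = multichoose ∣ B ∣ j ≤ ∣ j · B ∣

  extremal-split : ∀ j {B b} → b ∈ B → Extremal (suc j) B
    → Extremal j B × Extremal (suc j) (B - b) × Disjoint (translate b (j · B)) (suc j · (B - b))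
  extremal-split j {B} {b} b∈B extremal =
    j·B-extremal , proj₂ a≤∣X∣×d≤∣Y∣ , ∣p∣+∣q∣≤∣p∪q∣⇒Disjoint X Y ∣X∣+∣Y∣≤∣X∪Y∣
    where
    open ≤-Reasoning
    X = translate b (j · B)
    Y = suc j · (B - b)
    c = ∣ B - b ∣
    a = multichoose (suc c) j
    d = multichoose c (suc j)
    ∣B∣≡1+c : ∣ B ∣ ≡ suc c
    ∣B∣≡1+c = sym (x∈p⇒suc∣p-x∣≡∣p∣ b∈B)
    ∣X∣≤a : ∣ X ∣ ≤ a
    ∣X∣≤a = ≤-trans (≤-reflexive (∣translate∣≡∣X∣ b (j · B))) (∣j·B∣≤multichoose j B ∣B∣≡1+c)
    ∣Y∣≤d : ∣ Y ∣ ≤ d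
    ∣Y∣≤d = ∣j·B∣≤multichoose (suc j) (B - b) refl
    a+d≤∣X∪Y∣ : a + d ≤ ∣ X ∪ Y ∣
    a+d≤∣X∪Y∣ = begin
      a + d                        ≡⟨ multichoose-pascal c j ⟩
      multichoose (suc c) (suc j)  ≡⟨ cong (λ c → multichoose c (suc j)) ∣B∣≡1+c ⟨
      multichoose ∣ B ∣ (suc j)    ≤⟨ extremal ⟩
      ∣ suc j · B ∣                ≤⟨ p⊆q⇒∣p∣≤∣q∣ (suc·B⊆b+j·B∪suc·[B-b] b j) ⟩
      ∣ X ∪ Y ∣                    ∎
    ∣X∣+∣Y∣≤∣X∪Y∣ : ∣ X ∣ + ∣ Y ∣ ≤ ∣ X ∪ Y ∣
    ∣X∣+∣Y∣≤∣X∪Y∣ = ≤-trans (+-mono-≤ ∣X∣≤a ∣Y∣≤d) a+d≤∣X∪Y∣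
    a≤∣X∣×d≤∣Y∣ : a ≤ ∣ X ∣ × d ≤ ∣ Y ∣
    a≤∣X∣×d≤∣Y∣ = +-squeeze-≤ ∣X∣≤a ∣Y∣≤d (≤-trans a+d≤∣X∪Y∣ (∣p∪q∣≤∣p∣+∣q∣ X Y))
    j·B-extremal : Extremal j B
    j·B-extremal = begin
      multichoose ∣ B ∣ j  ≡⟨ cong (λ c → multichoose c j) ∣B∣≡1+c ⟩
      a                    ≤⟨ proj₁ a≤∣X∣×d≤∣Y∣ ⟩
      ∣ X ∣                ≡⟨ ∣translate∣≡∣X∣ b (j · B) ⟩
      ∣ j · B ∣            ∎

  extremal⇒no-collision : ∀ k {A b b′ u w} → Extremal (suc k) A → b ∈ A → b′ ∈ A - b
    → u ∈ k · (A - b) → w ∈ k · A → b′ ∙ u ≢ b ∙ w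
  extremal⇒no-collision k {A} {b} extremal b∈A b′∈A-b u∈ w∈ b′u≡bw =
    proj₂ (proj₂ (extremal-split k b∈A extremal)) (∈-translate⁺ {b} {k · A} w∈)
      (subst (_∈ suc k · (A - b)) b′u≡bw (∈-sumset⁺ _∙_ {A = A - b} {B = k · (A - b)} b′∈A-b u∈))

  module _ {k A} (extremal : Extremal (suc k) A) {a₀} (a₀∈A : a₀ ∈ A) where

    slice : Fin m → Subset m
    slice b = translate (a₀ ∙ (b ⁻¹)) (k · (A - b))

    private
      b∈A-a₀⇒b∈A : ∀ {b} → b ∈ A - a₀ → b ∈ A
      b∈A-a₀⇒b∈A = p─q⊆p A ⁅ a₀ ⁆

      b∈A-a₀⇒a₀∈A-b : ∀ {b} → b ∈ A - a₀ → a₀ ∈ A - b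
      b∈A-a₀⇒a₀∈A-b b∈A-a₀ = x∈p∧x≢y⇒x∈p-y a₀∈A (x∈p-y⇒x≢y b∈A-a₀ ∘ sym)

    slice-large : ∀ {b} → b ∈ A - a₀ → multichoose ∣ A - b ∣ k ≤ ∣ slice b ∣
    slice-large {b} b∈A-a₀ = begin
      multichoose ∣ A - b ∣ k  ≤⟨ proj₁ (extremal-split k (b∈A-a₀⇒a₀∈A-b b∈A-a₀) [A-b]-extremal) ⟩
      ∣ k · (A - b) ∣          ≡⟨ ∣translate∣≡∣X∣ (a₀ ∙ (b ⁻¹)) (k · (A - b)) ⟨
      ∣ slice b ∣              ∎
      where
      open ≤-Reasoning
      [A-b]-extremal : Extremal (suc k) (A - b)
      [A-b]-extremal = proj₁ (proj₂ (extremal-split k (b∈A-a₀⇒b∈A b∈A-a₀) extremal))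

    slices-disjoint : PairwiseDisjoint (A - a₀) slice
    slices-disjoint {b} {b′} b∈A-a₀ b′∈A-a₀ b≢b′ z∈slice-b z∈slice-b′
      with ∈-translate⁻ (a₀ ∙ (b ⁻¹)) (k · (A - b)) z∈slice-b | ∈-translate⁻ (a₀ ∙ (b′ ⁻¹)) (k · (A - b′)) z∈slice-b′
    ... | u , u∈ , refl | w , w∈ , eq =
      extremal⇒no-collision k extremal (b∈A-a₀⇒b∈A b∈A-a₀) b′∈A-b u∈ w∈k·A
        ([ab⁻¹]u≡[ab′⁻¹]w⇒b′u≡bw a₀ b b′ u w (sym eq))
      where
      b′∈A-b : b′ ∈ A - b
      b′∈A-b = x∈p∧x≢y⇒x∈p-y (b∈A-a₀⇒b∈A b′∈A-a₀) (b≢b′ ∘ sym)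
      w∈k·A : w ∈ k · A
      w∈k·A = kfold-mono _∙_ k (p─q⊆p A ⁅ b′ ⁆) w∈

    slices-disjoint-from-k·A : Disjoint (k · A) (⋃[ A - a₀ ] slice)
    slices-disjoint-from-k·A {z} z∈k·A z∈⋃ with ∈-⋃⁻ (A - a₀) slice z∈⋃
    ... | b , b∈A-a₀ , z∈slice-b with ∈-translate⁻ (a₀ ∙ (b ⁻¹)) (k · (A - b)) z∈slice-b
    ... | u , u∈ , refl =
      extremal⇒no-collision k extremal (b∈A-a₀⇒b∈A b∈A-a₀) (b∈A-a₀⇒a₀∈A-b b∈A-a₀) u∈ z∈k·A
        (sym (b[ab⁻¹u]≡au a₀ b u))

  extremal⇒order-bound : ∀ e k A → ∣ A ∣ ≡ suc e → Extremal (suc k) A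
    → multichoose (suc e) k + e * multichoose e k ≤ m
  extremal⇒order-bound e k A ∣A∣≡1+e extremal with ∣p∣≡suc⇒Nonempty A ∣A∣≡1+e
  ... | a₀ , a₀∈A = begin
    multichoose (suc e) k + e * multichoose e k  ≤⟨ +-mono-≤ k·A-large ⋃slices-large ⟩
    ∣ k · A ∣ + ∣ ⋃[ A - a₀ ] S ∣                ≡⟨ Disjoint⇒∣p∪q∣≡∣p∣+∣q∣ (k · A) (⋃[ A - a₀ ] S)
                                                      (slices-disjoint-from-k·A extremal a₀∈A) ⟨
    ∣ k · A ∪ ⋃[ A - a₀ ] S ∣                    ≤⟨ ∣p∣≤n (k · A ∪ ⋃[ A - a₀ ] S) ⟩
    m                                            ∎
    where
    open ≤-Reasoning
    S = slice extremal a₀∈A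
    k·A-large : multichoose (suc e) k ≤ ∣ k · A ∣
    k·A-large = subst (λ c → multichoose c k ≤ ∣ k · A ∣) ∣A∣≡1+e (proj₁ (extremal-split k a₀∈A extremal))
    slices-large : ∀ {b} → b ∈ A - a₀ → multichoose e k ≤ ∣ S b ∣
    slices-large b∈A-a₀ = subst (λ c → multichoose c k ≤ _)
      (x∈p⇒∣p∣≡1+c⇒∣p-x∣≡c (p─q⊆p A ⁅ a₀ ⁆ b∈A-a₀) ∣A∣≡1+e) (slice-large extremal a₀∈A b∈A-a₀)
    ⋃slices-large : e * multichoose e k ≤ ∣ ⋃[ A - a₀ ] S ∣
    ⋃slices-large = subst (λ c → c * multichoose e k ≤ ∣ ⋃[ A - a₀ ] S ∣) (x∈p⇒∣p∣≡1+c⇒∣p-x∣≡c a₀∈A ∣A∣≡1+e)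
      (∣D∣*s≤∣⋃[D]S∣ (A - a₀) S slices-large (slices-disjoint extremal a₀∈A))

lemma4p1 : (m : ℕ) (_+ᴳ_ : Fin m → Fin m → Fin m) (0ᴳ : Fin m) (-ᴳ_ : Fin m → Fin m)
    → IsAbelianGroup _≡_ _+ᴳ_ 0ᴳ -ᴳ_
    → (e k : ℕ) (A : Subset m) → ∣ A ∣ ≡ suc e
    → 0 < k
    → m < (e + k ∸ 1) C (k ∸ 1) + e * ((e + k ∸ 2) C (k ∸ 1))
    → ∣ kfold _+ᴳ_ 0ᴳ k A ∣ < (e + k) C k
lemma4p1 m _+ᴳ_ 0ᴳ -ᴳ_ isAbelianGroup e (suc k) A ∣A∣≡1+e (s≤s z≤n) m<bound =
  ≰⇒> λ extremal → <⇒≱ m<bound′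
    (extremal⇒order-bound isAbelianGroup e k A ∣A∣≡1+e
      (subst (λ c → multichoose c (suc k) ≤ ∣ kfold _+ᴳ_ 0ᴳ (suc k) A ∣) (sym ∣A∣≡1+e) extremal))
  where
  m<bound′ : m < multichoose (suc e) k + e * multichoose e k
  m<bound′ = subst (λ n → m < (n ∸ 1) C k + e * ((n ∸ 2) C k)) (+-suc e k) m<bound
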